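{- Let $n\ge 4$ be an integer, let $x$ be an integer with $2\le x\le n-2$ and $x\equiv n\pmod 2$, and let $k$ be an integer with $\left\lfloor\frac{n}{n-x+1}\right\rfloor\le k\le\left\lfloor\frac{x}{2}\right\rfloor$. Then $$\hat F_n(x,k)=\begin{cases}\displaystyle\sum_{i=0}^{\lfloor\frac{k-2}{2}\rfloor}F_{\lfloor\frac n2\rfloor-i-1}\!\left(\left\lfloor\tfrac x2\right\rfloor-i,k\right)+\sum_{j=0}^{k}F_{\frac{n-k}{2}-1}\!\left(\tfrac{x-k}{2},j\right) & \text{if } k+n \text{ is even},\\[4pt] \displaystyle\sum_{i=0}^{\lfloor\frac{k-1}{2}\rfloor}F_{\lfloor\frac n2\rfloor-i-1}\!\left(\left\lfloor\tfrac x2\right\rfloor-i,k\right) & \text{if } k+n \text{ is odd},\end{cases}$$ where an empty sum (upper limit smaller than the lower limit) equals $0$.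
   Context: For integers $m\ge 0$ and $y,j\ge 0$, $B_m^{y,j}$ denotes the set of binary strings of length $m$ that contain exactly $y$ zeros and in which the longest block of consecutive zeros has length exactly $j$ (the all-ones string, including the empty string, lies in $B_m^{0,0}$); $F_m(y,j)=|B_m^{y,j}|$, which is $0$ when no such string exists, and $F_m(y,j)=0$ for $m<0$. $\hat B_n^{x,k}$ denotes the set of palindromic binary strings (equal to their reversal) of length $n$ with exactly $x$ zeros and longest block of consecutive zeros of length exactly $k$, and $\hat F_n(x,k)=|\hat B_n^{x,k}|$. -}

module Defs where

open import Data.Bool using (Bool; true; false; _∧_)
open import Data.Nat using (ℕ; zero; suc; _+_; _⊔_; _≡ᵇ_)
open import Data.List using (List; []; _∷_; map; _++_; upTo)
open import Data.Nat.ListAction using (sum)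
open import Data.Vec using (Vec; []; _∷_; reverse)

-- all binary strings of length m (false = 0, true = 1)
allStrings : (m : ℕ) → List (Vec Bool m)
allStrings zero = [] ∷ []
allStrings (suc m) = map (false ∷_) (allStrings m) ++ map (true ∷_) (allStrings m)

zeros : ∀ {m} → Vec Bool m → ℕ
zeros [] = 0
zeros (false ∷ s) = suc (zeros s)
zeros (true ∷ s) = zeros s

maxRunAux : ∀ {m} → ℕ → Vec Bool m → ℕ
maxRunAux cur [] = cur
maxRunAux cur (false ∷ s) = maxRunAux (suc cur) s
maxRunAux cur (true ∷ s) = cur ⊔ maxRunAux 0 s

maxRun : ∀ {m} → Vec Bool m → ℕ
maxRun s = maxRunAux 0 s

_≡ᵛ_ : ∀ {m} → Vec Bool m → Vec Bool m → Bool
[] ≡ᵛ [] = true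
(true ∷ s) ≡ᵛ (true ∷ t) = s ≡ᵛ t
(false ∷ s) ≡ᵛ (false ∷ t) = s ≡ᵛ t
(true ∷ s) ≡ᵛ (false ∷ t) = false
(false ∷ s) ≡ᵛ (true ∷ t) = false

countWhere : ∀ {A : Set} → (A → Bool) → List A → ℕ
countWhere p [] = 0
countWhere p (a ∷ as) with p a
... | true = suc (countWhere p as)
... | false = countWhere p as

F : ℕ → ℕ → ℕ → ℕ
F m y j = countWhere (λ s → (zeros s ≡ᵇ y) ∧ (maxRun s ≡ᵇ j)) (allStrings m)

F̂ : ℕ → ℕ → ℕ → ℕ
F̂ n x k = countWhere (λ s → (s ≡ᵛ reverse s) ∧ ((zeros s ≡ᵇ x) ∧ (maxRun s ≡ᵇ k))) (allStrings n)

-- Σ over i = 0 .. N-1 (N terms; N = 0 gives the empty sum)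
sumBelow : ℕ → (ℕ → ℕ) → ℕ
sumBelow N f = sum (map f (upTo N))

-- Write n = h + e + h with e = n mod 2.  A palindrome of length n is determined by
-- its right half w (of length h) and its centre (of length e); since x ≡ n (mod 2)
-- the centre must be 0^e.  The palindrome  reverse w · 0^e · w  has  2·zeros(w) + e
-- zeros, and its longest zero block is the larger of the longest block of w and
-- the central block, of length 2·lead(w) + e, where lead(w) is the length of the
-- leading zero block of w.  Hence  F̂ n x k  counts the halves w with x/2 zeros and
-- max(maxRun w, 2·lead w + e) = k  (palindromeCount).
--
-- These halves are then sorted by lead(w) = i, peeling the zeros off one at a
-- time (halfCount-odd, halfCount-even).  A half with i leading zeros and then a 1
-- contributes F(h-i-1, x/2-i, k) while 2i + e < k, all of Σ_{j≤k} F(h-i-1, x/2-i, j)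
-- when 2i + e = k, and nothing once 2i + e > k.  The parity of k + n decides
-- whether the boundary case 2i + e = k occurs, giving the two formulas.

module Submission where

open import Defs
open import Data.Nat using (ℕ; suc; _+_; _∸_; _≤_; _/_; _%_)
open import Relation.Binary.PropositionalEquality using (_≡_)
open import Data.Product using (_×_)

open import Data.Bool using (Bool; true; false; _∧_; T)
open import Data.Bool.Properties using (⇔→≡; T-≡; ∧-zeroʳ)
open import Data.Empty using (⊥-elim)
open import Data.List as List using (List; applyUpTo; _ʳ++_)
import Data.List.Properties as ListP
open import Data.Nat using (zero; _*_; _<_; _⊔_; _≡ᵇ_; _<ᵇ_; z≤n; s≤s)
open import Data.Nat.DivMod using (m≡m%n+[m/n]*n; m%n<n; %-distribˡ-+; m*n/n≡m)
open import Data.Nat.ListAction using (sum)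
open import Data.Nat.ListAction.Properties using (sum-++)
open import Data.Nat.Properties
open import Algebra.Properties.CommutativeSemigroup +-commutativeSemigroup
  using (interchange)
open import Data.Nat.Tactic.RingSolver using (solve-∀)
open import Data.Product using (_,_)
open import Data.Vec using (Vec; []; _∷_; _++_; reverse; replicate; toList)
open import Data.Vec.Properties
  using (toList-++; toList-reverse; toList-replicate; toList-injective; cast-is-id;
         ++-injectiveˡ; reverse-involutive; ∷-injectiveʳ)
open import Function.Bundles using (Equivalence; mk⇔)
open import Relation.Binary.PropositionalEquality
  using (refl; sym; trans; cong; cong₂; subst; subst₂; module ≡-Reasoning)
open import Relation.Nullary using (¬_; yes; no)
open import Relation.Binary using (tri<; tri≈; tri>)

ind : Bool → ℕ
ind true = 1
ind false = 0

T-ext : ∀ {a b : Bool} → (T a → T b) → (T b → T a) → a ≡ b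
T-ext f g = ⇔→≡ {z = true} (mk⇔ (λ p → to T-≡ (f (from T-≡ p))) (λ p → to T-≡ (g (from T-≡ p))))
  where open Equivalence

≡ᵇ-cong : ∀ {a b c d} → (a ≡ b → c ≡ d) → (c ≡ d → a ≡ b) → (a ≡ᵇ b) ≡ (c ≡ᵇ d)
≡ᵇ-cong {a} {b} {c} {d} f g =
  T-ext (λ t → ≡⇒≡ᵇ c d (f (≡ᵇ⇒≡ a b t))) (λ t → ≡⇒≡ᵇ a b (g (≡ᵇ⇒≡ c d t)))

≡ᵇ-false : ∀ {a b} → ¬ (a ≡ b) → (a ≡ᵇ b) ≡ false
≡ᵇ-false {a} {b} a≢b = T-ext (λ t → a≢b (≡ᵇ⇒≡ a b t)) (λ ())

ind-∧-false : ∀ {a b} → b ≡ false → ind (a ∧ b) ≡ 0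
ind-∧-false {a} refl = cong ind (∧-zeroʳ a)

sumAll : (m : ℕ) → (Vec Bool m → ℕ) → ℕ
sumAll zero f = f []
sumAll (suc m) f = sumAll m (λ w → f (false ∷ w)) + sumAll m (λ w → f (true ∷ w))

countWhere-++ : ∀ {A : Set} (p : A → Bool) xs ys →
                countWhere p (xs List.++ ys) ≡ countWhere p xs + countWhere p ys
countWhere-++ p List.[] ys = refl
countWhere-++ p (a List.∷ as) ys with p a
... | true = cong suc (countWhere-++ p as ys)
... | false = countWhere-++ p as ys

countWhere-map : ∀ {A B : Set} (p : B → Bool) (f : A → B) xs →
                 countWhere p (List.map f xs) ≡ countWhere (λ a → p (f a)) xs
countWhere-map p f List.[] = refl
countWhere-map p f (a List.∷ as) with p (f a)
... | true = cong suc (countWhere-map p f as)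
... | false = countWhere-map p f as

count-allStrings : ∀ m (p : Vec Bool m → Bool) →
                   countWhere p (allStrings m) ≡ sumAll m (λ w → ind (p w))
count-allStrings zero p with p []
... | true = refl
... | false = refl
count-allStrings (suc m) p =
  trans (countWhere-++ p (List.map (false ∷_) (allStrings m)) (List.map (true ∷_) (allStrings m)))
        (cong₂ _+_ (trans (countWhere-map p (false ∷_) (allStrings m)) (count-allStrings m (λ w → p (false ∷ w))))
                   (trans (countWhere-map p (true ∷_) (allStrings m)) (count-allStrings m (λ w → p (true ∷ w)))))

sumAll-cong : ∀ m {f g : Vec Bool m → ℕ} → (∀ w → f w ≡ g w) → sumAll m f ≡ sumAll m g
sumAll-cong zero f≡g = f≡g []
sumAll-cong (suc m) f≡g =
  cong₂ _+_ (sumAll-cong m (λ w → f≡g (false ∷ w))) (sumAll-cong m (λ w → f≡g (true ∷ w)))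

sumAll-zero : ∀ m {f : Vec Bool m → ℕ} → (∀ w → f w ≡ 0) → sumAll m f ≡ 0
sumAll-zero m f≡0 = trans (sumAll-cong m f≡0) (zeros-sum m)
  where
  zeros-sum : ∀ m → sumAll m (λ _ → 0) ≡ 0
  zeros-sum zero = refl
  zeros-sum (suc m) = cong₂ _+_ (zeros-sum m) (zeros-sum m)

sumAll-+ : ∀ m (f g : Vec Bool m → ℕ) → sumAll m (λ w → f w + g w) ≡ sumAll m f + sumAll m g
sumAll-+ zero f g = refl
sumAll-+ (suc m) f g =
  trans (cong₂ _+_ (sumAll-+ m (λ w → f (false ∷ w)) (λ w → g (false ∷ w)))
                   (sumAll-+ m (λ w → f (true ∷ w)) (λ w → g (true ∷ w))))
        (interchange (sumAll m (λ w → f (false ∷ w))) (sumAll m (λ w → g (false ∷ w)))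
                     (sumAll m (λ w → f (true ∷ w))) (sumAll m (λ w → g (true ∷ w))))

sumAll-++ : ∀ a b (f : Vec Bool (a + b) → ℕ) →
            sumAll (a + b) f ≡ sumAll a (λ u → sumAll b (λ v → f (u ++ v)))
sumAll-++ zero b f = refl
sumAll-++ (suc a) b f = cong₂ _+_ (sumAll-++ a b _) (sumAll-++ a b _)

sumAll-swap : ∀ a b (f : Vec Bool a → Vec Bool b → ℕ) →
              sumAll a (λ u → sumAll b (λ v → f u v)) ≡ sumAll b (λ v → sumAll a (λ u → f u v))
sumAll-swap zero b f = refl
sumAll-swap (suc a) b f = trans (cong₂ _+_ (sumAll-swap a b _) (sumAll-swap a b _)) (sym (sumAll-+ b _ _))

sumAll-single : ∀ a (t : Vec Bool a) (f : Vec Bool a → ℕ) →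
                (∀ u → ¬ (u ≡ t) → f u ≡ 0) → sumAll a f ≡ f t
sumAll-single zero [] f off-t = refl
sumAll-single (suc a) (false ∷ t) f off-t =
  trans (cong₂ _+_ (sumAll-single a t _ (λ u u≢t → off-t (false ∷ u) (λ eq → u≢t (∷-injectiveʳ eq))))
                   (sumAll-zero a (λ u → off-t (true ∷ u) (λ ()))))
        (+-identityʳ _)
sumAll-single (suc a) (true ∷ t) f off-t =
  cong₂ _+_ (sumAll-zero a (λ u → off-t (false ∷ u) (λ ())))
            (sumAll-single a t _ (λ u u≢t → off-t (true ∷ u) (λ eq → u≢t (∷-injectiveʳ eq))))

-- sumUpTo N f = f 0 + … + f (N-1); unlike sumBelow it unfolds definitionally.
sumUpTo : ℕ → (ℕ → ℕ) → ℕ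
sumUpTo N f = sum (applyUpTo f N)

sumBelow≡sumUpTo : ∀ N f → sumBelow N f ≡ sumUpTo N f
sumBelow≡sumUpTo N f = cong sum (ListP.map-applyUpTo (λ i → i) f N)

sumUpTo-cong : ∀ N {f g : ℕ → ℕ} → (∀ i → f i ≡ g i) → sumUpTo N f ≡ sumUpTo N g
sumUpTo-cong zero f≡g = refl
sumUpTo-cong (suc N) f≡g = cong₂ _+_ (f≡g 0) (sumUpTo-cong N (λ i → f≡g (suc i)))

sumUpTo-snoc : ∀ N f → sumUpTo (suc N) f ≡ sumUpTo N f + f N
sumUpTo-snoc N f =
  trans (cong sum (sym (ListP.applyUpTo-∷ʳ f N)))
        (trans (sum-++ (applyUpTo f N) (f N List.∷ List.[])) (cong (sumUpTo N f +_) (+-identityʳ (f N))))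

sumAll-below : ∀ m (z : Vec Bool m → Bool) (r : Vec Bool m → ℕ) K →
               sumAll m (λ w → ind (z w ∧ (r w <ᵇ K)))
               ≡ sumUpTo K (λ j → sumAll m (λ w → ind (z w ∧ (r w ≡ᵇ j))))
sumAll-below m z r zero = sumAll-zero m (λ w → ind-∧-false (<ᵇ-zero (r w)))
  where
  <ᵇ-zero : ∀ r → (r <ᵇ 0) ≡ false
  <ᵇ-zero zero = refl
  <ᵇ-zero (suc r) = refl
sumAll-below m z r (suc K) = begin
  sumAll m (λ w → ind (z w ∧ (r w <ᵇ suc K)))
    ≡⟨ sumAll-cong m (λ w → split (z w) (r w) K) ⟩
  sumAll m (λ w → ind (z w ∧ (r w <ᵇ K)) + ind (z w ∧ (r w ≡ᵇ K)))
    ≡⟨ sumAll-+ m _ _ ⟩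
  sumAll m (λ w → ind (z w ∧ (r w <ᵇ K))) + sumAll m (λ w → ind (z w ∧ (r w ≡ᵇ K)))
    ≡⟨ cong (_+ sumAll m (λ w → ind (z w ∧ (r w ≡ᵇ K)))) (sumAll-below m z r K) ⟩
  sumUpTo K (λ j → sumAll m (λ w → ind (z w ∧ (r w ≡ᵇ j)))) + sumAll m (λ w → ind (z w ∧ (r w ≡ᵇ K)))
    ≡⟨ sym (sumUpTo-snoc K _) ⟩
  sumUpTo (suc K) (λ j → sumAll m (λ w → ind (z w ∧ (r w ≡ᵇ j)))) ∎
  where
  open ≡-Reasoning
  <ᵇ-suc : ∀ r K → ind (r <ᵇ suc K) ≡ ind (r <ᵇ K) + ind (r ≡ᵇ K)
  <ᵇ-suc zero zero = refl
  <ᵇ-suc zero (suc K) = refl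
  <ᵇ-suc (suc r) zero = refl
  <ᵇ-suc (suc r) (suc K) = <ᵇ-suc r K
  split : ∀ b r K → ind (b ∧ (r <ᵇ suc K)) ≡ ind (b ∧ (r <ᵇ K)) + ind (b ∧ (r ≡ᵇ K))
  split true r K = <ᵇ-suc r K
  split false r K = refl

-- Number of zeros, longest zero block and leading zero block of lists; the
-- reversed half of a palindrome is analysed through List's reverse-append _ʳ++_.
-- runL c l and leadL c l treat l as preceded by c further zeros;
-- innerRunL l is the longest zero block of l after its first 1 (0 if l has no 1).
zerosL : List Bool → ℕ
zerosL List.[] = 0
zerosL (false List.∷ l) = suc (zerosL l)
zerosL (true List.∷ l) = zerosL l

runL : ℕ → List Bool → ℕ
runL c List.[] = c
runL c (false List.∷ l) = runL (suc c) l
runL c (true List.∷ l) = c ⊔ runL 0 l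

leadL : ℕ → List Bool → ℕ
leadL c List.[] = c
leadL c (false List.∷ l) = leadL (suc c) l
leadL c (true List.∷ l) = c

innerRunL : List Bool → ℕ
innerRunL List.[] = 0
innerRunL (false List.∷ l) = innerRunL l
innerRunL (true List.∷ l) = runL 0 l

lead : ∀ {m} → ℕ → Vec Bool m → ℕ
lead c [] = c
lead c (false ∷ w) = lead (suc c) w
lead c (true ∷ w) = c

zeros-toList : ∀ {m} (s : Vec Bool m) → zeros s ≡ zerosL (toList s)
zeros-toList [] = refl
zeros-toList (false ∷ s) = cong suc (zeros-toList s)
zeros-toList (true ∷ s) = zeros-toList s

maxRunAux-toList : ∀ {m} c (s : Vec Bool m) → maxRunAux c s ≡ runL c (toList s)
maxRunAux-toList c [] = refl
maxRunAux-toList c (false ∷ s) = maxRunAux-toList (suc c) s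
maxRunAux-toList c (true ∷ s) = cong (c ⊔_) (maxRunAux-toList 0 s)

lead-toList : ∀ {m} c (s : Vec Bool m) → lead c s ≡ leadL c (toList s)
lead-toList c [] = refl
lead-toList c (false ∷ s) = lead-toList (suc c) s
lead-toList c (true ∷ s) = refl

zerosL-++ : ∀ A B → zerosL (A List.++ B) ≡ zerosL A + zerosL B
zerosL-++ List.[] B = refl
zerosL-++ (false List.∷ A) B = cong suc (zerosL-++ A B)
zerosL-++ (true List.∷ A) B = zerosL-++ A B

zerosL-ʳ++ : ∀ A B → zerosL (A ʳ++ B) ≡ zerosL A + zerosL B
zerosL-ʳ++ List.[] B = refl
zerosL-ʳ++ (false List.∷ A) B = trans (zerosL-ʳ++ A (false List.∷ B)) (+-suc (zerosL A) (zerosL B))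
zerosL-ʳ++ (true List.∷ A) B = zerosL-ʳ++ A (true List.∷ B)

zerosL-replicate : ∀ e → zerosL (List.replicate e false) ≡ e
zerosL-replicate zero = refl
zerosL-replicate (suc e) = cong suc (zerosL-replicate e)

leadL-shift : ∀ c l → leadL c l ≡ c + leadL 0 l
leadL-shift c List.[] = sym (+-identityʳ c)
leadL-shift c (false List.∷ l) = begin
  leadL (suc c) l ≡⟨ leadL-shift (suc c) l ⟩
  suc c + leadL 0 l ≡⟨ +-suc c (leadL 0 l) ⟨
  c + (1 + leadL 0 l) ≡⟨ cong (c +_) (leadL-shift 1 l) ⟨
  c + leadL 1 l ∎
  where open ≡-Reasoning
leadL-shift c (true List.∷ l) = sym (+-identityʳ c)

lead-≥ : ∀ {m} c (s : Vec Bool m) → c ≤ lead c s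
lead-≥ c s = subst (c ≤_) (sym (trans (lead-toList c s) (leadL-shift c (toList s)))) (m≤m+n c _)

runL-split : ∀ c l → runL c l ≡ innerRunL l ⊔ leadL c l
runL-split c List.[] = refl
runL-split c (false List.∷ l) = runL-split (suc c) l
runL-split c (true List.∷ l) = ⊔-comm c (runL 0 l)

-- Reading W backwards and then B: the leading block of W (now at the end of the
-- reversed part) merges with the leading zeros of B.
runL-ʳ++ : ∀ W B → runL 0 (W ʳ++ B) ≡ innerRunL W ⊔ runL (leadL 0 W) B
runL-ʳ++ List.[] B = refl
runL-ʳ++ (false List.∷ W) B =
  trans (runL-ʳ++ W (false List.∷ B)) (cong (λ z → innerRunL W ⊔ runL z B) (sym (leadL-shift 1 W)))
runL-ʳ++ (true List.∷ W) B =
  trans (runL-ʳ++ W (true List.∷ B))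
        (trans (sym (⊔-assoc (innerRunL W) (leadL 0 W) (runL 0 B)))
               (cong (_⊔ runL 0 B) (sym (runL-split 0 W))))

runL-replicate : ∀ e c l → runL c (List.replicate e false List.++ l) ≡ runL (e + c) l
runL-replicate zero c l = refl
runL-replicate (suc e) c l = trans (runL-replicate e (suc c) l) (cong (λ z → runL z l) (+-suc e c))

isPalindrome : ∀ {m} → Vec Bool m → Bool
isPalindrome s = s ≡ᵛ reverse s

hasProfile : ℕ → ℕ → ∀ {m} → Vec Bool m → Bool
hasProfile x k s = (zeros s ≡ᵇ x) ∧ (maxRun s ≡ᵇ k)

reflect : ∀ {e h} → Vec Bool e → Vec Bool h → Vec Bool (h + (e + h))
reflect c w = reverse w ++ (c ++ w)

≡ᵛ-sound : ∀ {m} (s t : Vec Bool m) → s ≡ᵛ t ≡ true → s ≡ t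
≡ᵛ-sound [] [] _ = refl
≡ᵛ-sound (true ∷ s) (true ∷ t) eq = cong (true ∷_) (≡ᵛ-sound s t eq)
≡ᵛ-sound (false ∷ s) (false ∷ t) eq = cong (false ∷_) (≡ᵛ-sound s t eq)
≡ᵛ-sound (true ∷ s) (false ∷ t) ()
≡ᵛ-sound (false ∷ s) (true ∷ t) ()

≡ᵛ-refl : ∀ {m} (s : Vec Bool m) → s ≡ᵛ s ≡ true
≡ᵛ-refl [] = refl
≡ᵛ-refl (true ∷ s) = ≡ᵛ-refl s
≡ᵛ-refl (false ∷ s) = ≡ᵛ-refl s

toList-++₃ : ∀ {a b d} (u : Vec Bool a) (c : Vec Bool b) (w : Vec Bool d) →
             toList (u ++ (c ++ w)) ≡ toList u List.++ (toList c List.++ toList w)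
toList-++₃ u c w = trans (toList-++ u (c ++ w)) (cong (toList u List.++_) (toList-++ c w))

reverse-++₃ : ∀ {a b} (u : Vec Bool a) (c : Vec Bool b) (w : Vec Bool a) →
              reverse (u ++ (c ++ w)) ≡ reverse w ++ (reverse c ++ reverse u)
reverse-++₃ u c w = trans (sym (cast-is-id refl _)) (toList-injective refl _ _ (begin
  toList (reverse (u ++ (c ++ w)))         ≡⟨ toList-reverse (u ++ (c ++ w)) ⟩
  List.reverse (toList (u ++ (c ++ w)))    ≡⟨ cong List.reverse (toList-++₃ u c w) ⟩
  List.reverse (U List.++ (C List.++ W))   ≡⟨ ListP.reverse-++ U (C List.++ W) ⟩
  List.reverse (C List.++ W) List.++ List.reverse U
    ≡⟨ cong (List._++ List.reverse U) (ListP.reverse-++ C W) ⟩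
  (List.reverse W List.++ List.reverse C) List.++ List.reverse U
    ≡⟨ ListP.++-assoc (List.reverse W) (List.reverse C) (List.reverse U) ⟩
  List.reverse W List.++ (List.reverse C List.++ List.reverse U)
    ≡⟨ sym (cong₂ (λ p q → p List.++ q) (toList-reverse w)
                  (cong₂ List._++_ (toList-reverse c) (toList-reverse u))) ⟩
  toList (reverse w) List.++ (toList (reverse c) List.++ toList (reverse u))
    ≡⟨ sym (toList-++₃ (reverse w) (reverse c) (reverse u)) ⟩
  toList (reverse w ++ (reverse c ++ reverse u)) ∎))
  where
  open ≡-Reasoning
  U = toList u
  C = toList c
  W = toList w

-- Among the strings u · c · w with |u| = |w| and c a palindrome, the palindromes
-- are exactly those with u = reverse w; so summing any test over palindromes of
-- this shape is summing it over the right halves w.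
module _ {e : ℕ} (c : Vec Bool e) (c-pal : reverse c ≡ c) where

  palindrome⇒mirrored : ∀ {h} (u w : Vec Bool h) →
                        u ++ (c ++ w) ≡ reverse (u ++ (c ++ w)) → u ≡ reverse w
  palindrome⇒mirrored u w pal =
    ++-injectiveˡ u (reverse w)
      (trans pal (trans (reverse-++₃ u c w) (cong (λ z → reverse w ++ (z ++ reverse u)) c-pal)))

  reflect-palindrome : ∀ {h} (w : Vec Bool h) → reverse (reflect c w) ≡ reflect c w
  reflect-palindrome w =
    trans (reverse-++₃ (reverse w) c w) (cong₂ (λ p q → reverse w ++ (p ++ q)) c-pal (reverse-involutive w))

  palindromes-around : ∀ h (q : Vec Bool (h + (e + h)) → Bool) →
                       sumAll h (λ u → sumAll h (λ w → ind (isPalindrome (u ++ (c ++ w)) ∧ q (u ++ (c ++ w)))))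
                       ≡ sumAll h (λ w → ind (q (reflect c w)))
  palindromes-around h q =
    trans (sumAll-swap h h _) (sumAll-cong h (λ w → trans (sumAll-single h (reverse w) _ (off w)) (at w)))
    where
    off : ∀ w u → ¬ (u ≡ reverse w) → ind (isPalindrome (u ++ (c ++ w)) ∧ q (u ++ (c ++ w))) ≡ 0
    off w u u≢rw with isPalindrome (u ++ (c ++ w)) in eq
    ... | true = ⊥-elim (u≢rw (palindrome⇒mirrored u w (≡ᵛ-sound _ _ eq)))
    ... | false = refl
    at : ∀ w → ind (isPalindrome (reflect c w) ∧ q (reflect c w)) ≡ ind (q (reflect c w))
    at w rewrite reflect-palindrome w | ≡ᵛ-refl (reflect c w) = refl

zeros-reflect : ∀ {e h} (c : Vec Bool e) (w : Vec Bool h) →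
                zeros (reflect c w) ≡ zeros w + (zeros c + zeros w)
zeros-reflect c w = begin
  zeros (reflect c w)                             ≡⟨ zeros-toList (reflect c w) ⟩
  zerosL (toList (reflect c w))                   ≡⟨ cong zerosL (toList-reflect c w) ⟩
  zerosL (toList w ʳ++ (toList c List.++ toList w)) ≡⟨ zerosL-ʳ++ (toList w) _ ⟩
  zerosL (toList w) + zerosL (toList c List.++ toList w)
    ≡⟨ cong (zerosL (toList w) +_) (zerosL-++ (toList c) (toList w)) ⟩
  zerosL (toList w) + (zerosL (toList c) + zerosL (toList w))
    ≡⟨ sym (cong₂ (λ p q → p + (q + p)) (zeros-toList w) (zeros-toList c)) ⟩
  zeros w + (zeros c + zeros w) ∎
  where
  open ≡-Reasoning
  toList-reflect : ∀ {e h} (c : Vec Bool e) (w : Vec Bool h) →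
                   toList (reflect c w) ≡ toList w ʳ++ (toList c List.++ toList w)
  toList-reflect c w =
    trans (toList-++₃ (reverse w) c w)
          (trans (cong (List._++ (toList c List.++ toList w)) (toList-reverse w)) (sym (ListP.ʳ++-defn (toList w))))

-- mirrorRun e c w is the longest zero block of the palindrome
-- reverse (0^c w) · 0^e · 0^c w: the longest block of 0^c w, or the central one.
mirrorRun : ℕ → ℕ → ∀ {m} → Vec Bool m → ℕ
mirrorRun e c w = maxRunAux c w ⊔ (lead c w + lead c w + e)

maxRun-reflect : ∀ {h} e (w : Vec Bool h) → maxRun (reflect (replicate e false) w) ≡ mirrorRun e 0 w
maxRun-reflect e w = begin
  maxRun (reflect (replicate e false) w)
    ≡⟨ maxRunAux-toList 0 (reflect (replicate e false) w) ⟩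
  runL 0 (toList (reflect (replicate e false) w))
    ≡⟨ cong (runL 0) toList-reflect ⟩
  runL 0 (W ʳ++ (List.replicate e false List.++ W))  ≡⟨ runL-ʳ++ W _ ⟩
  I ⊔ runL L (List.replicate e false List.++ W)      ≡⟨ cong (I ⊔_) (runL-replicate e L W) ⟩
  I ⊔ runL (e + L) W                                 ≡⟨ cong (I ⊔_) (runL-split (e + L) W) ⟩
  I ⊔ (I ⊔ leadL (e + L) W)                          ≡⟨ cong (λ z → I ⊔ (I ⊔ z)) central ⟩
  I ⊔ (I ⊔ (L + L + e))                              ≡⟨ sym (⊔-assoc I I _) ⟩
  (I ⊔ I) ⊔ (L + L + e)                              ≡⟨ cong (_⊔ (L + L + e)) (⊔-idem I) ⟩
  I ⊔ (L + L + e)                                    ≡⟨ cong (I ⊔_) (sym (m≤n⇒m⊔n≡n L≤central)) ⟩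
  I ⊔ (L ⊔ (L + L + e))                              ≡⟨ ⊔-assoc I L _ ⟨
  (I ⊔ L) ⊔ (L + L + e)
    ≡⟨ cong₂ (λ p q → p ⊔ (q + q + e)) (sym (trans (maxRunAux-toList 0 w) (runL-split 0 W))) (sym (lead-toList 0 w)) ⟩
  mirrorRun e 0 w ∎
  where
  open ≡-Reasoning
  W = toList w
  I = innerRunL W
  L = leadL 0 W
  toList-reflect : toList (reflect (replicate e false) w) ≡ W ʳ++ (List.replicate e false List.++ W)
  toList-reflect = trans (toList-++₃ (reverse w) (replicate e false) w)
    (trans (cong₂ (λ p q → p List.++ (q List.++ W)) (toList-reverse w) (toList-replicate e false))
           (sym (ListP.ʳ++-defn W)))
  central : leadL (e + L) W ≡ L + L + e
  central = trans (leadL-shift (e + L) W) (reorder e L)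
    where
    reorder : ∀ e L → e + L + L ≡ L + L + e
    reorder = solve-∀
  L≤central : L ≤ L + L + e
  L≤central = ≤-trans (m≤m+n L L) (m≤m+n (L + L) e)

-- a ↦ a + (e + a) is strictly increasing, hence order-reflecting and injective.
mirror-≤ : ∀ e a b → a + (e + a) ≤ b + (e + b) → a ≤ b
mirror-≤ e a b le with a ≤? b
... | yes a≤b = a≤b
... | no a≰b = ⊥-elim (<⇒≱ (+-mono-< b<a (+-monoʳ-< e b<a)) le)
  where b<a = ≰⇒> a≰b

mirror-injective : ∀ e a b → a + (e + a) ≡ b + (e + b) → a ≡ b
mirror-injective e a b eq = ≤-antisym (mirror-≤ e a b (≤-reflexive eq)) (mirror-≤ e b a (≤-reflexive (sym eq)))

-- halfCount e k m c y counts the halves w of length m with y zeros such that the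
-- palindrome reverse (0^c w) · 0^e · 0^c w has longest zero block k.
halfCount : (e k m c y : ℕ) → ℕ
halfCount e k m c y = sumAll m (λ w → ind ((zeros w ≡ᵇ y) ∧ (mirrorRun e c w ≡ᵇ k)))

reflect-profile : ∀ {h} e y k (w : Vec Bool h) →
                  hasProfile (y + (e + y)) k (reflect (replicate e false) w)
                  ≡ (zeros w ≡ᵇ y) ∧ (mirrorRun e 0 w ≡ᵇ k)
reflect-profile e y k w = cong₂ _∧_ zeros-part (cong (_≡ᵇ k) (maxRun-reflect e w))
  where
  zeros-w : zeros (reflect (replicate e false) w) ≡ zeros w + (e + zeros w)
  zeros-w = trans (zeros-reflect (replicate e false) w)
                  (cong (λ z → zeros w + (z + zeros w)) (trans (zeros-toList (replicate e false))
                        (trans (cong zerosL (toList-replicate e false)) (zerosL-replicate e))))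
  zeros-part : (zeros (reflect (replicate e false) w) ≡ᵇ y + (e + y)) ≡ (zeros w ≡ᵇ y)
  zeros-part = ≡ᵇ-cong (λ eq → mirror-injective e (zeros w) y (trans (sym zeros-w) eq))
                       (λ eq → trans zeros-w (cong (λ z → z + (e + z)) eq))

-- Palindromes with centre 1 have an even number of zeros.
odd-centre-1 : ∀ {h} y k (w : Vec Bool h) → ind (hasProfile (y + (1 + y)) k (reflect (true ∷ []) w)) ≡ 0
odd-centre-1 y k w with zeros (reflect (true ∷ []) w) ≡ᵇ y + (1 + y) in eq
... | false = refl
... | true = ⊥-elim (even≢odd (zeros w) y (begin
  2 * zeros w                   ≡⟨ double (zeros w) ⟩
  zeros w + (0 + zeros w)       ≡⟨ zeros-reflect (true ∷ []) w ⟨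
  zeros (reflect (true ∷ []) w) ≡⟨ ≡ᵇ⇒≡ _ _ (subst T (sym eq) _) ⟩
  y + (1 + y)                   ≡⟨ double+1 y ⟩
  suc (2 * y) ∎))
  where
  open ≡-Reasoning
  double : ∀ a → 2 * a ≡ a + (0 + a)
  double = solve-∀
  double+1 : ∀ a → a + (1 + a) ≡ suc (2 * a)
  double+1 = solve-∀

palindromeCount : ∀ e → e ≤ 1 → ∀ h y k → F̂ (h + (e + h)) (y + (e + y)) k ≡ halfCount e k h 0 y
palindromeCount zero _ h y k = begin
  F̂ (h + h) x k                                                    ≡⟨ count-allStrings (h + h) P ⟩
  sumAll (h + h) (λ s → ind (P s))                                ≡⟨ sumAll-++ h h _ ⟩
  sumAll h (λ u → sumAll h (λ w → ind (P (u ++ w))))              ≡⟨ palindromes-around [] refl h (hasProfile x k) ⟩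
  sumAll h (λ w → ind (hasProfile x k (reflect [] w)))            ≡⟨ sumAll-cong h (λ w → cong ind (reflect-profile 0 y k w)) ⟩
  halfCount 0 k h 0 y ∎
  where
  open ≡-Reasoning
  x = y + y
  P = λ (s : Vec Bool (h + h)) → isPalindrome s ∧ hasProfile x k s
palindromeCount (suc zero) _ h y k = begin
  F̂ (h + (1 + h)) x k                                              ≡⟨ count-allStrings (h + (1 + h)) P ⟩
  sumAll (h + (1 + h)) (λ s → ind (P s))                          ≡⟨ sumAll-++ h (1 + h) _ ⟩
  sumAll h (λ u → sumAll h (λ w → ind (P (u ++ (false ∷ w)))) + sumAll h (λ w → ind (P (u ++ (true ∷ w)))))
    ≡⟨ sumAll-+ h _ _ ⟩
  sumAll h (λ u → sumAll h (λ w → ind (P (u ++ (false ∷ w))))) + sumAll h (λ u → sumAll h (λ w → ind (P (u ++ (true ∷ w)))))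
    ≡⟨ cong₂ _+_ (palindromes-around (false ∷ []) refl h (hasProfile x k))
                 (palindromes-around (true ∷ []) refl h (hasProfile x k)) ⟩
  sumAll h (λ w → ind (hasProfile x k (reflect (false ∷ []) w))) + sumAll h (λ w → ind (hasProfile x k (reflect (true ∷ []) w)))
    ≡⟨ cong₂ _+_ (sumAll-cong h (λ w → cong ind (reflect-profile 1 y k w))) (sumAll-zero h (odd-centre-1 y k)) ⟩
  halfCount 1 k h 0 y + 0                                         ≡⟨ +-identityʳ _ ⟩
  halfCount 1 k h 0 y ∎
  where
  open ≡-Reasoning
  x = y + (1 + y)
  P = λ (s : Vec Bool (h + (1 + h))) → isPalindrome s ∧ hasProfile x k s
palindromeCount (suc (suc e)) (s≤s ())

-- The peeling step: a half either starts with another 0 (one more peeled zero),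
-- or with a 1, closing the leading block at length c.
closedCount : (e k m c y : ℕ) → ℕ
closedCount e k m c y = sumAll m (λ w → ind ((zeros w ≡ᵇ y) ∧ (mirrorRun e c (true ∷ w) ≡ᵇ k)))

halfCount-suc : ∀ e k m c y → halfCount e k (suc m) c (suc y) ≡ halfCount e k m (suc c) y + closedCount e k m c (suc y)
halfCount-suc e k m c y = refl

halfCount-no-zeros : ∀ e k m c → halfCount e k (suc m) c 0 ≡ closedCount e k m c 0
halfCount-no-zeros e k m c = cong (_+ closedCount e k m c 0) (sumAll-zero m (λ w → refl))

halfCount-vanish : ∀ e k m c y → k < c + c + e → halfCount e k m c y ≡ 0
halfCount-vanish e k m c y k<central = sumAll-zero m (λ w → ind-∧-false (≡ᵇ-false (too-long w)))
  where
  too-long : ∀ w → ¬ (mirrorRun e c w ≡ k)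
  too-long w eq = <-irrefl refl (<-≤-trans k<central (subst (c + c + e ≤_) eq central≤))
    where
    central≤ : c + c + e ≤ mirrorRun e c w
    central≤ = ≤-trans (+-monoˡ-≤ e (+-mono-≤ (lead-≥ c w) (lead-≥ c w))) (m≤n⊔m _ _)

-- A block closed strictly below k leaves the longest block to the rest: F m y k.
closedCount-below : ∀ e k m c y → c + c + e < k → closedCount e k m c y ≡ F m y k
closedCount-below e k m c y central<k =
  trans (sumAll-cong m (λ w → cong (λ z → ind ((zeros w ≡ᵇ y) ∧ z)) (rest-decides (maxRun w))))
        (sym (count-allStrings m (hasProfile y k)))
  where
  c<k : c < k
  c<k = ≤-<-trans (≤-trans (m≤m+n c c) (m≤m+n (c + c) e)) central<k
  rest-decides : ∀ r → (((c ⊔ r) ⊔ (c + c + e)) ≡ᵇ k) ≡ (r ≡ᵇ k)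
  rest-decides r = ≡ᵇ-cong forward (λ r≡k → trans (cong (λ z → (c ⊔ z) ⊔ (c + c + e)) r≡k) at-k)
    where
    at-k : (c ⊔ k) ⊔ (c + c + e) ≡ k
    at-k = trans (cong (_⊔ (c + c + e)) (m≤n⇒m⊔n≡n (<⇒≤ c<k))) (m≥n⇒m⊔n≡m (<⇒≤ central<k))
    forward : (c ⊔ r) ⊔ (c + c + e) ≡ k → r ≡ k
    forward eq with <-cmp r k
    ... | tri≈ _ r≡k _ = r≡k
    ... | tri< r<k _ _ = ⊥-elim (<-irrefl eq (⊔-lub (⊔-lub c<k r<k) central<k))
    ... | tri> _ _ r>k = ⊥-elim (<-irrefl (sym eq) (<-≤-trans r>k (≤-trans (m≤n⊔m c r) (m≤m⊔n _ _))))

-- A block closed at exactly k allows any rest with longest block j ≤ k.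
closedCount-at : ∀ e k m c y → c + c + e ≡ k → closedCount e k m c y ≡ sumUpTo (suc k) (F m y)
closedCount-at e k m c y central≡k =
  trans (sumAll-cong m (λ w → cong (λ z → ind ((zeros w ≡ᵇ y) ∧ z))
                          (trans (cong (λ d → ((c ⊔ maxRun w) ⊔ d) ≡ᵇ k) central≡k) (rest-bounded (maxRun w)))))
        (trans (sumAll-below m (λ w → zeros w ≡ᵇ y) maxRun (suc k))
               (sumUpTo-cong (suc k) (λ j → sym (count-allStrings m (hasProfile y j)))))
  where
  c≤k : c ≤ k
  c≤k = subst (c ≤_) central≡k (≤-trans (m≤m+n c c) (m≤m+n (c + c) e))
  rest-bounded : ∀ r → (((c ⊔ r) ⊔ k) ≡ᵇ k) ≡ (r <ᵇ suc k)
  rest-bounded r = T-ext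
    (λ t → <⇒<ᵇ (s≤s (subst (r ≤_) (≡ᵇ⇒≡ _ _ t) (≤-trans (m≤n⊔m c r) (m≤m⊔n _ k)))))
    (λ t → ≡⇒≡ᵇ _ _ (m≤n⇒m⊔n≡n (⊔-lub c≤k (≤-pred (<ᵇ⇒< r (suc k) t)))))

peel-room : ∀ N X K → suc N + suc N + X ≡ K → suc X < K
peel-room N X K eq = subst (suc (suc X) ≤_) (trans (sym (reorder N X)) eq) (m≤n+m (suc (suc X)) (N + N))
  where
  reorder : ∀ N X → suc N + suc N + X ≡ (N + N) + suc (suc X)
  reorder = solve-∀

peel-shift : ∀ N c e → suc N + suc N + (c + c + e) ≡ N + N + (suc c + suc c + e)
peel-shift = solve-∀

-- If 2N + (2c + e) = k + 1, the leading block stays below k for all N admissible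
-- lengths, and exceeds k afterwards.
halfCount-odd : ∀ e k N m c y → N + N + (c + c + e) ≡ suc k → N ≤ m → N ≤ y →
                halfCount e k m c y ≡ sumUpTo N (λ i → F (m ∸ i ∸ 1) (y ∸ i) k)
halfCount-odd e k zero m c y eq _ _ = halfCount-vanish e k m c y (subst (k <_) (sym eq) ≤-refl)
halfCount-odd e k (suc N) (suc m) c (suc y) eq (s≤s N≤m) (s≤s N≤y) = begin
  halfCount e k (suc m) c (suc y)                       ≡⟨ halfCount-suc e k m c y ⟩
  halfCount e k m (suc c) y + closedCount e k m c (suc y)
    ≡⟨ cong₂ _+_ (halfCount-odd e k N m (suc c) y (trans (sym (peel-shift N c e)) eq) N≤m N≤y)
                 (closedCount-below e k m c (suc y) (≤-pred (peel-room N (c + c + e) (suc k) eq))) ⟩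
  sumUpTo N (λ i → F (m ∸ i ∸ 1) (y ∸ i) k) + F m (suc y) k
    ≡⟨ +-comm _ (F m (suc y) k) ⟩
  F m (suc y) k + sumUpTo N (λ i → F (m ∸ i ∸ 1) (y ∸ i) k) ∎
  where open ≡-Reasoning

-- If 2N + (2c + e) = k, the leading block reaches exactly k after N peeled zeros.
halfCount-even : ∀ e k N m c y → N + N + (c + c + e) ≡ k → N < m → N ≤ y →
                 halfCount e k m c y
                 ≡ sumUpTo N (λ i → F (m ∸ i ∸ 1) (y ∸ i) k) + sumUpTo (suc k) (F (m ∸ N ∸ 1) (y ∸ N))
halfCount-even e k zero (suc m) c zero eq _ _ =
  trans (halfCount-no-zeros e k m c) (closedCount-at e k m c zero eq)
halfCount-even e k zero (suc m) c (suc y) eq _ _ =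
  trans (halfCount-suc e k m c y) (cong₂ _+_ (halfCount-vanish e k m (suc c) y (subst (_< suc c + suc c + e) eq central<))
            (closedCount-at e k m c (suc y) eq))
  where
  central< : c + c + e < suc c + suc c + e
  central< = +-monoˡ-< e (+-mono-< (n<1+n c) (n<1+n c))
halfCount-even e k (suc N) (suc m) c (suc y) eq (s≤s N<m) (s≤s N≤y) = begin
  halfCount e k (suc m) c (suc y)                       ≡⟨ halfCount-suc e k m c y ⟩
  halfCount e k m (suc c) y + closedCount e k m c (suc y)
    ≡⟨ cong₂ _+_ (halfCount-even e k N m (suc c) y (trans (sym (peel-shift N c e)) eq) N<m N≤y)
                 (closedCount-below e k m c (suc y) (<-trans (n<1+n _) (peel-room N (c + c + e) k eq))) ⟩
  (A + B) + F m (suc y) k ≡⟨ reorder A B (F m (suc y) k) ⟩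
  (F m (suc y) k + A) + B ∎
  where
  open ≡-Reasoning
  A = sumUpTo N (λ i → F (m ∸ i ∸ 1) (y ∸ i) k)
  B = sumUpTo (suc k) (F (m ∸ N ∸ 1) (y ∸ N))
  reorder : ∀ A B C → (A + B) + C ≡ (C + A) + B
  reorder = solve-∀

halves : ∀ m → m / 2 + m / 2 + m % 2 ≡ m
halves m = sym (trans (m≡m%n+[m/n]*n m 2) (reorder (m % 2) (m / 2)))
  where
  reorder : ∀ r q → r + q * 2 ≡ q + q + r
  reorder = solve-∀

halves-around : ∀ m → m ≡ m / 2 + (m % 2 + m / 2)
halves-around m = sym (trans (reorder (m / 2) (m % 2)) (halves m))
  where
  reorder : ∀ h e → h + (e + h) ≡ h + h + e
  reorder = solve-∀

mirror-< : ∀ e a b → a + (e + a) + 2 ≤ b + (e + b) → a < b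
mirror-< e a b le = mirror-≤ e (suc a) b (subst (_≤ b + (e + b)) (reorder a e) le)
  where
  reorder : ∀ a e → a + (e + a) + 2 ≡ suc a + (e + suc a)
  reorder = solve-∀

residues-even : ∀ r s → r < 2 → s < 2 → (r + s) % 2 ≡ 0 → r ≡ s
residues-even zero zero _ _ _ = refl
residues-even zero (suc zero) _ _ ()
residues-even (suc zero) zero _ _ ()
residues-even (suc zero) (suc zero) _ _ _ = refl
residues-even (suc (suc r)) s (s≤s (s≤s ())) _ _
residues-even r (suc (suc s)) _ (s≤s (s≤s ())) _

residues-odd : ∀ r s → r < 2 → s < 2 → (r + s) % 2 ≡ 1 → (r + 1) % 2 ≡ s
residues-odd zero zero _ _ ()
residues-odd zero (suc zero) _ _ _ = refl
residues-odd (suc zero) zero _ _ _ = refl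
residues-odd (suc zero) (suc zero) _ _ ()
residues-odd (suc (suc r)) s (s≤s (s≤s ())) _ _
residues-odd r (suc (suc s)) _ (s≤s (s≤s ())) _

even-split : ∀ k n → (k + n) % 2 ≡ 0 → k / 2 + k / 2 + n % 2 ≡ k
even-split k n p = trans (cong (k / 2 + k / 2 +_) (sym same)) (halves k)
  where
  same : k % 2 ≡ n % 2
  same = residues-even (k % 2) (n % 2) (m%n<n k 2) (m%n<n n 2) (trans (sym (%-distribˡ-+ k n 2)) p)

odd-split : ∀ k n → (k + n) % 2 ≡ 1 → (k + 1) / 2 + (k + 1) / 2 + n % 2 ≡ suc k
odd-split k n p = trans (cong ((k + 1) / 2 + (k + 1) / 2 +_) (sym opposite)) (trans (halves (k + 1)) (+-comm k 1))
  where
  opposite : (k + 1) % 2 ≡ n % 2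
  opposite = trans (%-distribˡ-+ k 1 2)
    (residues-odd (k % 2) (n % 2) (m%n<n k 2) (m%n<n n 2) (trans (sym (%-distribˡ-+ k n 2)) p))

halve-∸ : ∀ a e N → N ≤ a → (a + (e + a) ∸ (N + N + e)) / 2 ≡ a ∸ N
halve-∸ a e N N≤a = begin
  (a + (e + a) ∸ (N + N + e)) / 2
    ≡⟨ cong (λ z → (z + (e + z) ∸ (N + N + e)) / 2) (sym (m+[n∸m]≡n N≤a)) ⟩
  ((N + d) + (e + (N + d)) ∸ (N + N + e)) / 2 ≡⟨ cong (λ z → (z ∸ (N + N + e)) / 2) (reorder N e d) ⟩
  ((N + N + e) + d * 2 ∸ (N + N + e)) / 2    ≡⟨ cong (_/ 2) (m+n∸m≡n (N + N + e) (d * 2)) ⟩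
  (d * 2) / 2                                ≡⟨ m*n/n≡m d 2 ⟩
  d ∎
  where
  open ≡-Reasoning
  d = a ∸ N
  reorder : ∀ N e d → (N + d) + (e + (N + d)) ≡ (N + N + e) + d * 2
  reorder = solve-∀

half-≤-pred : ∀ N e k → N + N + e ≡ suc k → N ≤ k
half-≤-pred zero e k _ = z≤n
half-≤-pred (suc N) e k eq = subst (suc N ≤_) (suc-injective (trans (reorder N e) eq)) (m≤n+m (suc N) (N + e))
  where
  reorder : ∀ N e → suc (N + e + suc N) ≡ suc N + suc N + e
  reorder = solve-∀

even-formula : ∀ {n x k} h e y → n ≡ h + (e + h) → x ≡ y + (e + y) → y < h → k ≤ y →
               k / 2 + k / 2 + e ≡ k →
               halfCount e k h 0 y ≡ sumBelow (k / 2) (λ i → F (h ∸ i ∸ 1) (y ∸ i) k)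
                                     + sumBelow (k + 1) (λ j → F ((n ∸ k) / 2 ∸ 1) ((x ∸ k) / 2) j)
even-formula {n} {x} {k} h e y n≡ x≡ y<h k≤y k≡ = begin
  halfCount e k h 0 y
    ≡⟨ halfCount-even e k N h 0 y k≡ (≤-<-trans N≤y y<h) N≤y ⟩
  sumUpTo N f + sumUpTo (suc k) (F (h ∸ N ∸ 1) (y ∸ N))
    ≡⟨ cong₂ _+_ (sym (sumBelow≡sumUpTo N f))
                 (sumUpTo-cong (suc k) (λ j → cong₂ (λ a b → F (a ∸ 1) b j) (sym n-k) (sym x-k))) ⟩
  sumBelow N f + sumUpTo (suc k) g
    ≡⟨ cong (λ K → sumBelow N f + sumUpTo K g) (+-comm 1 k) ⟩
  sumBelow N f + sumUpTo (k + 1) g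
    ≡⟨ cong (sumBelow N f +_) (sym (sumBelow≡sumUpTo (k + 1) g)) ⟩
  sumBelow N f + sumBelow (k + 1) g ∎
  where
  open ≡-Reasoning
  N = k / 2
  f = λ i → F (h ∸ i ∸ 1) (y ∸ i) k
  g = λ j → F ((n ∸ k) / 2 ∸ 1) ((x ∸ k) / 2) j
  N≤y : N ≤ y
  N≤y = ≤-trans (subst (N ≤_) k≡ (≤-trans (m≤m+n N N) (m≤m+n (N + N) e))) k≤y
  n-k : (n ∸ k) / 2 ≡ h ∸ N
  n-k = trans (cong₂ (λ a b → (a ∸ b) / 2) n≡ (sym k≡)) (halve-∸ h e N (≤-trans N≤y (<⇒≤ y<h)))
  x-k : (x ∸ k) / 2 ≡ y ∸ N
  x-k = trans (cong₂ (λ a b → (a ∸ b) / 2) x≡ (sym k≡)) (halve-∸ y e N N≤y)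

odd-formula : ∀ h e y k → y < h → k ≤ y → (k + 1) / 2 + (k + 1) / 2 + e ≡ suc k →
              halfCount e k h 0 y ≡ sumBelow ((k + 1) / 2) (λ i → F (h ∸ i ∸ 1) (y ∸ i) k)
odd-formula h e y k y<h k≤y k+1≡ =
  trans (halfCount-odd e k N h 0 y k+1≡ (≤-trans N≤y (<⇒≤ y<h)) N≤y) (sym (sumBelow≡sumUpTo N _))
  where
  N = (k + 1) / 2
  N≤y : N ≤ y
  N≤y = ≤-trans (half-≤-pred N e k k+1≡) k≤y

-- Theorem 5.5.
theorem5p5 : (n x k : ℕ) → 4 ≤ n → 2 ≤ x → x ≤ n ∸ 2 → x % 2 ≡ n % 2
    → (n / suc (n ∸ x)) ≤ k → k ≤ x / 2
    → ((k + n) % 2 ≡ 0 → F̂ n x k ≡ sumBelow (k / 2) (λ i → F (n / 2 ∸ i ∸ 1) (x / 2 ∸ i) k) + sumBelow (k + 1) (λ j → F ((n ∸ k) / 2 ∸ 1) ((x ∸ k) / 2) j))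
      × ((k + n) % 2 ≡ 1 → F̂ n x k ≡ sumBelow ((k + 1) / 2) (λ i → F (n / 2 ∸ i ∸ 1) (x / 2 ∸ i) k))
theorem5p5 n x k 4≤n _ x≤n∸2 x≡n _ k≤y =
  (λ p → trans F̂≡ (even-formula h e y n≡ x≡ y<h k≤y (even-split k n p))) ,
  (λ p → trans F̂≡ (odd-formula h e y k y<h k≤y (odd-split k n p)))
  where
  h = n / 2
  e = n % 2
  y = x / 2
  n≡ : n ≡ h + (e + h)
  n≡ = halves-around n
  x≡ : x ≡ y + (e + y)
  x≡ = trans (halves-around x) (cong (λ r → y + (r + y)) x≡n)
  y<h : y < h
  y<h = mirror-< e y h (subst₂ (λ a b → a + 2 ≤ b) x≡ n≡ (m≤o∸n⇒m+n≤o x (≤-trans (s≤s (s≤s z≤n)) 4≤n) x≤n∸2))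
  F̂≡ : F̂ n x k ≡ halfCount e k h 0 y
  F̂≡ = trans (cong₂ (λ a b → F̂ a b k) n≡ x≡) (palindromeCount e (≤-pred (m%n<n n 2)) h y k)
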